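{- Let $A$ be a commutative unitary ring, $x\in A$, $u\in U(A)$ and $a\in A\setminus U(A)$. (i) For every $n\ge1$ there exists $(a_1,\dots,a_n)\in A^n$ with $K_n(a_1,\dots,a_n)=x$. (ii) For every $n\ge2$ there exists $(a_1,\dots,a_n)\in A^n$ such that $K_n(a_1,\dots,a_n)=a$ and $K_{n-1}(a_1,\dots,a_{n-1})=u$.
   Context: $U(A)$ is the unit group of $A$. The continuants are defined by $K_{ -1}:=0_A$, $K_0:=1_A$, and for $i\ge1$, $K_i(X_1,\dots,X_i)$ is the determinant of the $i\times i$ tridiagonal matrix with diagonal $X_1,\dots,X_i$ and all entries on the sub- and super-diagonal equal to $1_A$. -}

module Defs where

open import Level using (Level)
import Level
open import Algebra.Bundles using (CommutativeRing)
open import Data.Nat using (ℕ; zero; suc)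
open import Data.Fin using (Fin; inject₁; fromℕ)
open import Data.Product using (∃)

module _ {c ℓ : Level} (R : CommutativeRing c ℓ) where
  open CommutativeRing R

  IsUnit : Carrier → Set (c Level.⊔ ℓ)
  IsUnit x = ∃ λ y → x * y ≈ 1#

  -- continuant K_n(X_1,…,X_n), the determinant of the n×n tridiagonal matrix with
  -- diagonal X_1..X_n and 1 on sub/super-diagonal; computed by cofactor expansion
  -- along the last row: K_{-1} = 0, K_0 = 1, K_i = X_i K_{i-1} - K_{i-2}.
  -- Kpair n X = (K_{n-1}(X_1..X_{n-1}), K_n(X_1..X_n)), where X (fin i) is X_{i+1}.
  record Pair : Set c where
    constructor _,,_
    field prev cur : Carrier

  Kpair : (n : ℕ) → (Fin n → Carrier) → Pair
  Kpair zero X = 0# ,, 1#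
  Kpair (suc n) X with Kpair n (λ i → X (inject₁ i))
  ... | p ,, k = k ,, (X (fromℕ n) * k - p)

  K : (n : ℕ) → (Fin n → Carrier) → Carrier
  K n X = Pair.cur (Kpair n X)

-- Expanding the continuant along its last entry gives
-- K_{n+1}(X_1,…,X_n,y) = y K_n(X) − K_{n−1}(X), which is affine in y with slope K_n(X).
-- If that slope is a unit, y can be chosen to make K_{n+1} any prescribed value.
-- Since K_0 = 1 is a unit, induction makes K_{n+1} surjective for every n ≥ 0; in
-- particular some (X_1,…,X_m) has K_m = u, and extending it by one entry hits any value
-- with K_{m−1} = u still in place.
module Submission where

open import Defs
open import Level using (Level)
open import Algebra.Bundles using (CommutativeRing)
import Algebra.Properties.AbelianGroup as AbelianGroupProperties
open import Data.Nat using (ℕ; zero; suc; _≥_; s≤s)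
open import Data.Fin using (Fin; inject₁; fromℕ; zero; suc)
open import Data.Product using (_×_; ∃; _,_)
open import Data.Vec.Functional using (Vector; []; init; last)
open import Function using (_∘_)
open import Relation.Nullary using (¬_)
open import Relation.Binary.PropositionalEquality as ≡ using (_≡_; _≗_)
import Relation.Binary.Reasoning.Setoid as SetoidReasoning

module Continuant {c ℓ : Level} (R : CommutativeRing c ℓ) where
  open CommutativeRing R hiding (zero)
  open AbelianGroupProperties +-abelianGroup using (//-rightDividesʳ)
  open Pair

  infixl 5 _∷ʳ_

  _∷ʳ_ : ∀ {n} → Vector Carrier n → Carrier → Vector Carrier (suc n)
  _∷ʳ_ {zero}  X y zero    = y
  _∷ʳ_ {suc n} X y zero    = X zero
  _∷ʳ_ {suc n} X y (suc i) = (X ∘ suc ∷ʳ y) i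

  init-∷ʳ : ∀ {n} (X : Vector Carrier n) y → init (X ∷ʳ y) ≗ X
  init-∷ʳ {suc n} X y zero    = ≡.refl
  init-∷ʳ {suc n} X y (suc i) = init-∷ʳ (X ∘ suc) y i

  last-∷ʳ : ∀ {n} (X : Vector Carrier n) y → last (X ∷ʳ y) ≡ y
  last-∷ʳ {zero}  X y = ≡.refl
  last-∷ʳ {suc n} X y = last-∷ʳ (X ∘ suc) y

  Kpair-cong : ∀ {n} {X Y : Vector Carrier n} → X ≗ Y → Kpair R n X ≡ Kpair R n Y
  Kpair-cong {zero}          X≗Y = ≡.refl
  Kpair-cong {suc n} {X} {Y} X≗Y
    with Kpair R n (init X) | Kpair R n (init Y) | Kpair-cong {n} (X≗Y ∘ inject₁)
  ... | p ,, k | .p ,, .k | ≡.refl = ≡.cong (λ z → k ,, (z * k - p)) (X≗Y (fromℕ n))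

  K-suc : ∀ {n} (X : Vector Carrier (suc n)) →
          K R (suc n) X ≡ last X * K R n (init X) - prev (Kpair R n (init X))
  K-suc {n} X with Kpair R n (init X)
  ... | p ,, k = ≡.refl

  K-∷ʳ : ∀ {n} (X : Vector Carrier n) y →
         K R (suc n) (X ∷ʳ y) ≡ y * K R n X - prev (Kpair R n X)
  K-∷ʳ {n} X y = ≡.trans (K-suc (X ∷ʳ y))
    (≡.cong₂ (λ z P → z * cur P - prev P) (last-∷ʳ X y) (Kpair-cong (init-∷ʳ X y)))

  1#-isUnit : IsUnit R 1#
  1#-isUnit = 1# , *-identityʳ 1#

  open SetoidReasoning setoid

  K-∷ʳ-solvable : ∀ {n} (X : Vector Carrier n) {w} → K R n X ≈ w → IsUnit R w →
                  ∀ b → ∃ λ y → K R (suc n) (X ∷ʳ y) ≈ b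
  K-∷ʳ-solvable {n} X {w} KX≈w (v , wv≈1) b = y , (begin
    K R (suc n) (X ∷ʳ y)   ≡⟨ K-∷ʳ X y ⟩
    y * K R n X - p        ≈⟨ +-congʳ (*-congˡ KX≈w) ⟩
    (b + p) * v * w - p    ≈⟨ +-congʳ (*-assoc (b + p) v w) ⟩
    (b + p) * (v * w) - p  ≈⟨ +-congʳ (*-congˡ (trans (*-comm v w) wv≈1)) ⟩
    (b + p) * 1# - p       ≈⟨ +-congʳ (*-identityʳ (b + p)) ⟩
    b + p - p              ≈⟨ //-rightDividesʳ p b ⟩
    b                      ∎)
    where
    p = prev (Kpair R n X)
    y = (b + p) * v

  K-surjective : ∀ n b → ∃ λ (X : Vector Carrier (suc n)) → K R (suc n) X ≈ b
  K-surjective zero b with K-∷ʳ-solvable [] refl 1#-isUnit b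
  ... | y , K≈b = [] ∷ʳ y , K≈b
  K-surjective (suc n) b with K-surjective n 1#
  ... | X , KX≈1 with K-∷ʳ-solvable X KX≈1 1#-isUnit b
  ... | y , K≈b = X ∷ʳ y , K≈b

  K-surjective-with-unit-prefix :
    ∀ m {u} → IsUnit R u → ∀ b → ∃ λ (X : Vector Carrier (suc (suc m))) →
    (K R (suc (suc m)) X ≈ b) × (K R (suc m) (init X) ≈ u)
  K-surjective-with-unit-prefix m u-unit b with K-surjective m _
  ... | X , KX≈u with K-∷ʳ-solvable X KX≈u u-unit b
  ... | y , K≈b = X ∷ʳ y , K≈b , (begin
    K R (suc m) (init (X ∷ʳ y))  ≡⟨ ≡.cong cur (Kpair-cong (init-∷ʳ X y)) ⟩
    K R (suc m) X                ≈⟨ KX≈u ⟩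
    _                            ∎)

lemma3p2 : ∀ {c ℓ : Level} (R : CommutativeRing c ℓ) →
    let open CommutativeRing R in
    (x u a : Carrier) → IsUnit R u → ¬ IsUnit R a →
    ((n : ℕ) → n ≥ 1 → ∃ λ (as : Fin n → Carrier) → K R n as ≈ x)
    × ((m : ℕ) → suc m ≥ 2 → ∃ λ (as : Fin (suc m) → Carrier) →
         (K R (suc m) as ≈ a) × (K R m (λ i → as (inject₁ i)) ≈ u))
lemma3p2 R x u a u-unit _ = part-i , part-ii
  where
  open CommutativeRing R using (Carrier; _≈_)
  open Continuant R
  part-i : ∀ n → n ≥ 1 → ∃ λ (as : Fin n → Carrier) → K R n as ≈ x
  part-i (suc n) _ = K-surjective n x
  part-ii : ∀ m → suc m ≥ 2 → ∃ λ (as : Fin (suc m) → Carrier) →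
            (K R (suc m) as ≈ a) × (K R m (init as) ≈ u)
  part-ii zero    (s≤s ())
  part-ii (suc m) _ = K-surjective-with-unit-prefix m u-unit a
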